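{- Let $T$ be a full binary tree of order $n$. Then $b(T)\le\lceil n^{1/2}\rceil$.
   Context: A full binary tree is a rooted tree in which every vertex has either $0$ or $2$ children. All graphs are finite and simple. For a connected graph $G$, a burning process is defined as follows: initially all vertices are unburned; in each round $r\ge 1$ one chooses an unburned vertex $x_r$ (the source of round $r$), and then burns $x_r$ together with every unburned vertex adjacent to a vertex that was already burned. Burned vertices stay burned, and the process terminates when all vertices are burned. If it terminates after $k$ rounds, $(x_1,\dots,x_k)$ is a burning sequence of length $k$. The burning number $b(G)$ is the minimum length of a burning sequence for $G$. -}

module Defs where

open import Data.Nat using (ℕ; suc; _+_; _*_; _≤_)
open import Data.List using (List; []; _∷_; reverse; length)
open import Data.Product using (Σ; ∃; _×_; _,_)
open import Data.Sum using (_⊎_)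
open import Data.Empty using (⊥)
open import Data.Unit using (⊤)
open import Relation.Nullary using (¬_)
open import Relation.Binary.PropositionalEquality using (_≡_)

-- BurnedAfter rs v : v is burned after the rounds whose sources are
-- listed in rs, MOST RECENT SOURCE FIRST (rs = x_r ∷ … ∷ x_1).
-- B_0 = ∅ ;  B_r = B_{r-1} ∪ N(B_{r-1}) ∪ {x_r}.
BurnedAfter : {V : Set} → (V → V → Set) → List V → V → Set
BurnedAfter Adj []       v = ⊥
BurnedAfter Adj (x ∷ rs) v =
  BurnedAfter Adj rs v ⊎ (Σ _ λ u → Adj u v × BurnedAfter Adj rs u) ⊎ v ≡ x

ValidSources : {V : Set} → (V → V → Set) → List V → Set
ValidSources Adj []       = ⊤
ValidSources Adj (x ∷ rs) = ValidSources Adj rs × ¬ BurnedAfter Adj rs x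

-- (x_1, …, x_k) in chronological order is a burning sequence.
IsBurningSequence : {V : Set} → (V → V → Set) → List V → Set
IsBurningSequence Adj xs =
  ValidSources Adj (reverse xs) × (∀ v → BurnedAfter Adj (reverse xs) v)

BurningNumber≤ : {V : Set} → (V → V → Set) → ℕ → Set
BurningNumber≤ Adj k =
  Σ _ λ xs → IsBurningSequence Adj xs × length xs ≤ k

data FBT : Set where
  leaf : FBT
  node : FBT → FBT → FBT

order : FBT → ℕ
order leaf       = 1
order (node l r) = suc (order l + order r)

data Vertex : FBT → Set where
  root  : ∀ {t} → Vertex t
  left  : ∀ {l r} → Vertex l → Vertex (node l r)
  right : ∀ {l r} → Vertex r → Vertex (node l r)

data ChildOf : {t : FBT} → Vertex t → Vertex t → Set where
  lchild : ∀ {l r} → ChildOf {node l r} (left root) root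
  rchild : ∀ {l r} → ChildOf {node l r} (right root) root
  inL    : ∀ {l r} {c p : Vertex l} → ChildOf c p → ChildOf {node l r} (left c) (left p)
  inR    : ∀ {l r} {c p : Vertex r} → ChildOf c p → ChildOf {node l r} (right c) (right p)

Adj : (t : FBT) → Vertex t → Vertex t → Set
Adj t u v = ChildOf u v ⊎ ChildOf v u

IsCeilSqrt : ℕ → ℕ → Set
IsCeilSqrt n k = n ≤ k * k × (∀ j → n ≤ j * j → k ≤ j)

-- By the characterisation of Bonato, Janssen and Roshanbin, it suffices to cover
-- the vertices by balls of radii 0, 1, …, k − 1 (a source lit in round i spreads
-- k − i steps by round k; sources that are already burning can be replaced by
-- unburned vertices or dropped).  If T has height at most k − 1, the ball of
-- radius k − 1 about the root covers it.  Otherwise T has a subtree S of height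
-- exactly k − 1, which in a full binary tree has at least 2k − 1 vertices.  The
-- ball of radius k − 1 about the root of S covers S and its parent p.  Deleting
-- S and contracting p leaves a full binary tree with at most k² − 2k < (k − 1)²
-- vertices, covered by induction by balls of radii 0, …, k − 2; in T, a walk
-- that crossed the contracted edge passes through p, so its end lies within
-- distance k − 1 of the root of S.
module Submission where

open import Defs
open import Data.Nat using (ℕ; zero; suc; _+_; _*_; _≤_; _<_; _⊔_; z≤n; s≤s; _≤?_)
open import Data.Nat.Properties
  using ( ≤-refl; ≤-reflexive; ≤-trans; <⇒≤; ≰⇒>; m≤n⇒m≤1+n; m≤n⇒m<n∨m≡n
        ; +-comm; +-assoc; +-mono-≤; +-monoˡ-≤; +-monoʳ-≤; +-cancelʳ-≤; *-monoʳ-≤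
        ; ⊔-sel; m⊔n≤m+n; m⊔n≤o⇒m≤o; m⊔n≤o⇒n≤o; module ≤-Reasoning )
open import Data.Nat.Tactic.RingSolver using (solve-∀)
open import Data.List using (List; []; _∷_; _++_; [_]; map; length; reverse)
open import Data.List.Properties using (unfold-reverse; reverse-involutive; length-reverse)
open import Data.List.Membership.Propositional using (_∈_; lose)
open import Data.List.Membership.Propositional.Properties using (∈-map⁺; ∈-++⁺ˡ; ∈-++⁺ʳ)
open import Data.List.Relation.Unary.Any using (here; there; any?; satisfied)
open import Data.Vec using (Vec; toList; replicate) renaming ([] to []ᵥ; _∷_ to _∷ᵥ_; map to mapᵥ)
open import Data.Vec.Properties using (length-toList)
open import Data.Product using (Σ; ∃; _×_; _,_)
import Data.Product as Product
open import Data.Sum using (_⊎_; inj₁; inj₂)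
import Data.Sum as Sum
open import Data.Empty using (⊥; ⊥-elim)
open import Function using (id)
open import Relation.Nullary using (¬_; Dec; yes; no)
open import Relation.Nullary.Decidable using (map′; _×-dec_; _⊎-dec_; ¬?; decidable-stable)
open import Relation.Unary using (_⊆_) renaming (Decidable to Decidable₁)
open import Relation.Binary.Definitions using (Decidable; DecidableEquality)
open import Relation.Binary.PropositionalEquality using (_≡_; refl; sym; trans; cong; subst)

data Within {V : Set} (A : V → V → Set) : ℕ → V → V → Set where
  start : ∀ {n x} → Within A n x x
  step  : ∀ {n x u v} → Within A n x u → A u v → Within A (suc n) x v

length-reverse-toList : ∀ {X : Set} {k} (xs : Vec X k) → length (reverse (toList xs)) ≡ k
length-reverse-toList xs = trans (length-reverse (toList xs)) (length-toList xs)

-- In a chronological list x₁ ∷ … ∷ xₖ the source xᵢ gets radius k − i, the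
-- number of rounds its fire spreads.
Covered : ∀ {V : Set} (A : V → V → Set) {k} → Vec V k → V → Set
Covered A []ᵥ               v = ⊥
Covered A (_∷ᵥ_ {n} x xs) v = Within A n x v ⊎ Covered A xs v

Covering : ∀ {V : Set} (A : V → V → Set) {k} → Vec V k → Set
Covering A xs = ∀ v → Covered A xs v

module _ {V : Set} {A : V → V → Set} where

  within-weaken : ∀ {m n x v} → m ≤ n → Within A m x v → Within A n x v
  within-weaken _         start      = start
  within-weaken (s≤s m≤n) (step p a) = step (within-weaken m≤n p) a

  within-cons : ∀ {n x y v} → A x y → Within A n y v → Within A (suc n) x v
  within-cons a start      = step start a
  within-cons a (step p b) = step (within-cons a p) b

  within-map : ∀ {W} {B : W → W → Set} (f : V → W) → (∀ {u v} → A u v → B (f u) (f v)) →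
               ∀ {n x v} → Within A n x v → Within B n (f x) (f v)
  within-map f f-hom start      = start
  within-map f f-hom (step p a) = step (within-map f f-hom p) (f-hom a)

  burnedAfter-∷-mono : ∀ {rs rs′ x y} → BurnedAfter A rs ⊆ BurnedAfter A rs′ →
                       BurnedAfter A (y ∷ rs′) x → BurnedAfter A (x ∷ rs) ⊆ BurnedAfter A (y ∷ rs′)
  burnedAfter-∷-mono sub bx (inj₁ b)                   = inj₁ (sub b)
  burnedAfter-∷-mono sub bx (inj₂ (inj₁ (u , a , b))) = inj₂ (inj₁ (u , a , sub b))
  burnedAfter-∷-mono sub bx (inj₂ (inj₂ refl))        = bx

  burnedAfter-++ : ∀ rs zs → BurnedAfter A rs ⊆ BurnedAfter A (rs ++ zs)
  burnedAfter-++ (x ∷ rs) zs = burnedAfter-∷-mono (burnedAfter-++ rs zs) (inj₂ (inj₂ refl))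

  burnedAfter-within : ∀ rs {x v} → Within A (length rs) x v → BurnedAfter A (rs ++ [ x ]) v
  burnedAfter-within []       start      = inj₂ (inj₂ refl)
  burnedAfter-within (_ ∷ rs) start      = inj₁ (burnedAfter-within rs start)
  burnedAfter-within (_ ∷ rs) (step p a) = inj₂ (inj₁ (_ , a , burnedAfter-within rs p))

  reverse-isBurningSequence : ∀ rs → ValidSources A rs → (∀ v → BurnedAfter A rs v) →
                              IsBurningSequence A (reverse rs)
  reverse-isBurningSequence rs valid burned rewrite reverse-involutive rs = valid , burned

  covered⇒burnedAfter : ∀ {k} (xs : Vec V k) → Covered A xs ⊆ BurnedAfter A (reverse (toList xs))
  covered⇒burnedAfter (x ∷ᵥ xs) {v} c rewrite unfold-reverse x (toList xs) with c
  ... | inj₁ near = burnedAfter-within (reverse (toList xs))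
                      (subst (λ n → Within A n x v) (sym (length-reverse-toList xs)) near)
  ... | inj₂ c′   = burnedAfter-++ (reverse (toList xs)) [ x ] (covered⇒burnedAfter xs c′)

module FiniteGraph {V : Set} {A : V → V → Set}
  (vertices : List V) (∈-vertices : ∀ v → v ∈ vertices)
  (A? : Decidable A) (_≟_ : DecidableEquality V) where

  burnedAfter? : ∀ rs → Decidable₁ (BurnedAfter A rs)
  burnedAfter? []       v = no λ ()
  burnedAfter? (x ∷ rs) v = burnedAfter? rs v ⊎-dec burnedNeighbour? ⊎-dec v ≟ x
    where
    burnedNeighbour? : Dec (Σ V λ u → A u v × BurnedAfter A rs u)
    burnedNeighbour? = map′ satisfied (λ (u , a , b) → lose (∈-vertices u) (a , b))
                            (any? (λ u → A? u v ×-dec burnedAfter? rs u) vertices)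

  unburned-or-allBurned : ∀ rs → (∃ λ w → ¬ BurnedAfter A rs w) ⊎ (∀ v → BurnedAfter A rs v)
  unburned-or-allBurned rs with any? (λ w → ¬? (burnedAfter? rs w)) vertices
  ... | yes some = inj₁ (satisfied some)
  ... | no none  = inj₂ λ v →
    decidable-stable (burnedAfter? rs v) (λ ¬b → none (lose (∈-vertices v) ¬b))

  -- An already burning source is replaced by an unburned vertex; if there is
  -- none, the round is dropped.
  validate : ∀ rs → Σ (List V) λ rs′ →
             ValidSources A rs′ × length rs′ ≤ length rs × BurnedAfter A rs ⊆ BurnedAfter A rs′
  validate []       = [] , _ , z≤n , λ ()
  validate (x ∷ rs) with validate rs
  ... | rs′ , valid , shorter , sub with burnedAfter? rs′ x | unburned-or-allBurned rs′
  ... | no ¬bx | _              =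
    x ∷ rs′ , (valid , ¬bx) , s≤s shorter , burnedAfter-∷-mono sub (inj₂ (inj₂ refl))
  ... | yes bx | inj₁ (w , ¬bw) =
    w ∷ rs′ , (valid , ¬bw) , s≤s shorter , burnedAfter-∷-mono sub (inj₁ bx)
  ... | yes _  | inj₂ allBurned =
    rs′ , valid , m≤n⇒m≤1+n shorter , λ {v} _ → allBurned v

  covering⇒burningNumber≤ : ∀ {k} (xs : Vec V k) → Covering A xs → BurningNumber≤ A k
  covering⇒burningNumber≤ {k} xs covering with validate (reverse (toList xs))
  ... | rs , valid , shorter , sub =
    reverse rs ,
    reverse-isBurningSequence rs valid (λ v → sub (covered⇒burnedAfter xs (covering v))) ,
    (begin
      length (reverse rs)           ≡⟨ length-reverse rs ⟩
      length rs                     ≤⟨ shorter ⟩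
      length (reverse (toList xs))  ≡⟨ length-reverse-toList xs ⟩
      k                             ∎)
    where open ≤-Reasoning

height : FBT → ℕ
height leaf       = 0
height (node l r) = suc (height l ⊔ height r)

withinˡ : ∀ {l r n u v} → Within (Adj l) n u v → Within (Adj (node l r)) n (left u) (left v)
withinˡ = within-map left (Sum.map inL inL)

withinʳ : ∀ {l r n u v} → Within (Adj r) n u v → Within (Adj (node l r)) n (right u) (right v)
withinʳ = within-map right (Sum.map inR inR)

root-within : ∀ {t n} → height t ≤ n → (v : Vertex t) → Within (Adj t) n root v
root-within _ root = start
root-within {node l r} (s≤s hl⊔hr≤n) (left v)  =
  within-cons (inj₂ lchild) (withinˡ (root-within (m⊔n≤o⇒m≤o (height l) (height r) hl⊔hr≤n) v))
root-within {node l r} (s≤s hl⊔hr≤n) (right v) =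
  within-cons (inj₂ rchild) (withinʳ (root-within (m⊔n≤o⇒n≤o (height l) (height r) hl⊔hr≤n) v))

2*height<order : ∀ t → 2 * height t < order t
2*height<order leaf       = s≤s z≤n
2*height<order (node l r) = s≤s (begin
  2 * suc (height l ⊔ height r)           ≤⟨ *-monoʳ-≤ 2 (s≤s (m⊔n≤m+n (height l) (height r))) ⟩
  2 * suc (height l + height r)           ≡⟨ double-split (height l) (height r) ⟩
  suc (2 * height l) + suc (2 * height r) ≤⟨ +-mono-≤ (2*height<order l) (2*height<order r) ⟩
  order l + order r                       ∎)
  where
  open ≤-Reasoning
  double-split : ∀ a b → 2 * suc (a + b) ≡ suc (2 * a) + suc (2 * b)
  double-split = solve-∀

-- Pruning h T T′ : T′ is T with a subtree of height h and its parent deleted,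
-- the sibling of the subtree taking the parent's place.
data Pruning (h : ℕ) : FBT → FBT → Set where
  cutˡ   : ∀ {a b} → height a ≡ h → Pruning h (node a b) b
  cutʳ   : ∀ {a b} → height b ≡ h → Pruning h (node a b) a
  underˡ : ∀ {l l′ r} → Pruning h l l′ → Pruning h (node l r) (node l′ r)
  underʳ : ∀ {l r r′} → Pruning h r r′ → Pruning h (node l r) (node l r′)

module _ {h : ℕ} where

  embed : ∀ {T T′} → Pruning h T T′ → Vertex T′ → Vertex T
  embed (cutˡ _)   w         = right w
  embed (cutʳ _)   w         = left w
  embed (underˡ _) root      = root
  embed (underˡ s) (left w)  = left (embed s w)
  embed (underˡ _) (right w) = right w
  embed (underʳ _) root      = root
  embed (underʳ _) (left w)  = left w
  embed (underʳ s) (right w) = right (embed s w)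

  cutRoot : ∀ {T T′} → Pruning h T T′ → Vertex T
  cutRoot (cutˡ _)   = left root
  cutRoot (cutʳ _)   = right root
  cutRoot (underˡ s) = left (cutRoot s)
  cutRoot (underʳ s) = right (cutRoot s)

  cutParent : ∀ {T T′} → Pruning h T T′ → Vertex T
  cutParent (cutˡ _)   = root
  cutParent (cutʳ _)   = root
  cutParent (underˡ s) = left (cutParent s)
  cutParent (underʳ s) = right (cutParent s)

  cutRoot-child : ∀ {T T′} (s : Pruning h T T′) → ChildOf (cutRoot s) (cutParent s)
  cutRoot-child (cutˡ _)   = lchild
  cutRoot-child (cutʳ _)   = rchild
  cutRoot-child (underˡ s) = inL (cutRoot-child s)
  cutRoot-child (underʳ s) = inR (cutRoot-child s)

  embed-child : ∀ {T T′} (s : Pruning h T T′) {c p} → ChildOf c p →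
                ChildOf (embed s c) (embed s p) ⊎
                (ChildOf (embed s c) (cutParent s) × ChildOf (cutParent s) (embed s p))
  embed-child (cutˡ _)            c      = inj₁ (inR c)
  embed-child (cutʳ _)            c      = inj₁ (inL c)
  embed-child (underˡ (cutˡ _))   lchild = inj₂ (inL rchild , lchild)
  embed-child (underˡ (cutʳ _))   lchild = inj₂ (inL lchild , lchild)
  embed-child (underˡ (underˡ _)) lchild = inj₁ lchild
  embed-child (underˡ (underʳ _)) lchild = inj₁ lchild
  embed-child (underˡ _)          rchild = inj₁ rchild
  embed-child (underˡ s)          (inL c) = Sum.map inL (Product.map inL inL) (embed-child s c)
  embed-child (underˡ _)          (inR c) = inj₁ (inR c)
  embed-child (underʳ (cutˡ _))   rchild = inj₂ (inR rchild , rchild)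
  embed-child (underʳ (cutʳ _))   rchild = inj₂ (inR lchild , rchild)
  embed-child (underʳ (underˡ _)) rchild = inj₁ rchild
  embed-child (underʳ (underʳ _)) rchild = inj₁ rchild
  embed-child (underʳ _)          lchild = inj₁ lchild
  embed-child (underʳ s)          (inR c) = Sum.map inR (Product.map inR inR) (embed-child s c)
  embed-child (underʳ _)          (inL c) = inj₁ (inL c)

  embed-adj : ∀ {T T′} (s : Pruning h T T′) {u w} → Adj T′ u w →
              Adj T (embed s u) (embed s w) ⊎ Adj T (cutParent s) (embed s w)
  embed-adj s (inj₁ c) = Sum.map inj₁ (λ (_ , pw) → inj₁ pw) (embed-child s c)
  embed-adj s (inj₂ c) = Sum.map inj₂ (λ (wp , _) → inj₂ wp) (embed-child s c)

  embed-within : ∀ {T T′} (s : Pruning h T T′) {n x w} → Within (Adj T′) n x w →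
                 Within (Adj T) n (embed s x) (embed s w) ⊎ Within (Adj T) (suc n) (cutRoot s) (embed s w)
  embed-within s start = inj₁ start
  embed-within s (step p a) with embed-within s p | embed-adj s a
  ... | _      | inj₂ pw =
    inj₂ (within-weaken (s≤s (s≤s z≤n)) (step (step start (inj₁ (cutRoot-child s))) pw))
  ... | inj₁ q | inj₁ a′ = inj₁ (step q a′)
  ... | inj₂ q | inj₁ a′ = inj₂ (step q a′)

  covered-embed : ∀ {T T′ m n} (s : Pruning h T T′) (ys : Vec (Vertex T′) n) → n ≤ m → ∀ {w} →
                  Covered (Adj T′) ys w →
                  Within (Adj T) m (cutRoot s) (embed s w) ⊎ Covered (Adj T) (mapᵥ (embed s) ys) (embed s w)
  covered-embed s (y ∷ᵥ ys) n<m (inj₁ near) =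
    Sum.map (within-weaken n<m) inj₁ (Sum.swap (embed-within s near))
  covered-embed s (y ∷ᵥ ys) n<m (inj₂ c)    =
    Sum.map id inj₂ (covered-embed s ys (<⇒≤ n<m) c)

pruned-vertex : ∀ {h T T′} (s : Pruning (suc h) T T′) (v : Vertex T) →
                (∃ λ w → embed s w ≡ v) ⊎ Within (Adj T) (suc h) (cutRoot s) v
pruned-vertex (cutˡ _)     root      = inj₂ (within-weaken (s≤s z≤n) (step start (inj₁ lchild)))
pruned-vertex (cutˡ ha)    (left v)  = inj₂ (withinˡ (root-within (≤-reflexive ha) v))
pruned-vertex (cutˡ _)     (right v) = inj₁ (v , refl)
pruned-vertex (cutʳ _)     root      = inj₂ (within-weaken (s≤s z≤n) (step start (inj₁ rchild)))
pruned-vertex (cutʳ _)     (left v)  = inj₁ (v , refl)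
pruned-vertex (cutʳ hb)    (right v) = inj₂ (withinʳ (root-within (≤-reflexive hb) v))
pruned-vertex (underˡ _)   root      = inj₁ (root , refl)
pruned-vertex (underˡ s)   (left v)  = Sum.map (Product.map left (cong left)) withinˡ (pruned-vertex s v)
pruned-vertex (underˡ _)   (right v) = inj₁ (right v , refl)
pruned-vertex (underʳ _)   root      = inj₁ (root , refl)
pruned-vertex (underʳ _)   (left v)  = inj₁ (left v , refl)
pruned-vertex (underʳ s)   (right v) = Sum.map (Product.map right (cong right)) withinʳ (pruned-vertex s v)

pruning-covering : ∀ {h T T′} (s : Pruning h T T′) (xs : Vec (Vertex T′) h) →
                   Covering (Adj T′) xs → Covering (Adj T) (cutRoot s ∷ᵥ mapᵥ (embed s) xs)
pruning-covering s []ᵥ          covering v = ⊥-elim (covering root)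
pruning-covering s xs@(_ ∷ᵥ _) covering v with pruned-vertex s v
... | inj₁ (w , refl) = covered-embed s xs ≤-refl (covering w)
... | inj₂ near       = inj₁ near

order-sibling : ∀ a b → order b + 2 * suc (height a) ≤ order (node a b)
order-sibling a b = begin
  order b + 2 * suc (height a)        ≡⟨ rearrange (order b) (height a) ⟩
  suc (suc (2 * height a) + order b)  ≤⟨ s≤s (+-monoˡ-≤ (order b) (2*height<order a)) ⟩
  suc (order a + order b)             ∎
  where
  open ≤-Reasoning
  rearrange : ∀ x y → x + 2 * suc y ≡ suc (suc (2 * y) + x)
  rearrange = solve-∀

order-pruned : ∀ {h T T′} → Pruning h T T′ → order T′ + 2 * suc h ≤ order T
order-pruned (cutˡ {a} {b} refl) = order-sibling a b
order-pruned (cutʳ {a} {b} refl) =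
  subst (order a + 2 * suc (height b) ≤_) (cong suc (+-comm (order b) (order a))) (order-sibling b a)
order-pruned {h} (underˡ {l} {l′} {r} s) = begin
  suc (order l′ + order r) + 2 * suc h  ≡⟨ rearrange (order l′) (order r) (2 * suc h) ⟩
  suc (order l′ + 2 * suc h + order r)  ≤⟨ s≤s (+-monoˡ-≤ (order r) (order-pruned s)) ⟩
  suc (order l + order r)               ∎
  where
  open ≤-Reasoning
  rearrange : ∀ x y z → suc (x + y) + z ≡ suc (x + z + y)
  rearrange = solve-∀
order-pruned {h} (underʳ {l} {r} {r′} s) = begin
  suc (order l + order r′) + 2 * suc h    ≡⟨ cong suc (+-assoc (order l) (order r′) (2 * suc h)) ⟩
  suc (order l + (order r′ + 2 * suc h))  ≤⟨ s≤s (+-monoʳ-≤ (order l) (order-pruned s)) ⟩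
  suc (order l + order r)                 ∎
  where open ≤-Reasoning

m+2[1+n]≤[1+n]²⇒m<n² : ∀ m n → m + 2 * suc n ≤ suc n * suc n → m < n * n
m+2[1+n]≤[1+n]²⇒m<n² m n le = +-cancelʳ-≤ (suc (2 * n)) (suc m) (n * n) (begin
  suc m + suc (2 * n)  ≡⟨ left-side m n ⟩
  m + 2 * suc n        ≤⟨ le ⟩
  suc n * suc n        ≡⟨ right-side n ⟩
  n * n + suc (2 * n)  ∎)
  where
  open ≤-Reasoning
  left-side : ∀ m n → suc m + suc (2 * n) ≡ m + 2 * suc n
  left-side = solve-∀
  right-side : ∀ n → suc n * suc n ≡ n * n + suc (2 * n)
  right-side = solve-∀

prune : ∀ {h} T → h < height T → Σ FBT (Pruning h T)
prune {h} (node l r) (s≤s h≤hl⊔hr) with ⊔-sel (height l) (height r)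
... | inj₁ hl⊔hr≡hl = inside-or-cutˡ (subst (h ≤_) hl⊔hr≡hl h≤hl⊔hr)
  where
  inside-or-cutˡ : h ≤ height l → Σ FBT (Pruning h (node l r))
  inside-or-cutˡ h≤hl with m≤n⇒m<n∨m≡n h≤hl
  ... | inj₁ h<hl = Product.map (λ l′ → node l′ r) underˡ (prune l h<hl)
  ... | inj₂ h≡hl = r , cutˡ (sym h≡hl)
... | inj₂ hl⊔hr≡hr = inside-or-cutʳ (subst (h ≤_) hl⊔hr≡hr h≤hl⊔hr)
  where
  inside-or-cutʳ : h ≤ height r → Σ FBT (Pruning h (node l r))
  inside-or-cutʳ h≤hr with m≤n⇒m<n∨m≡n h≤hr
  ... | inj₁ h<hr = Product.map (node l) underʳ (prune r h<hr)
  ... | inj₂ h≡hr = l , cutʳ (sym h≡hr)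

cover : ∀ k T → order T ≤ k * k → Σ (Vec (Vertex T) k) (Covering (Adj T))
cover zero    leaf       ()
cover zero    (node _ _) ()
cover (suc h) T le with height T ≤? h
... | yes shallow = root ∷ᵥ replicate h root , λ v → inj₁ (root-within shallow v)
... | no deep with prune T (≰⇒> deep)
...   | T′ , s with cover h T′ (<⇒≤ (m+2[1+n]≤[1+n]²⇒m<n² (order T′) h (≤-trans (order-pruned s) le)))
...     | xs , covering = cutRoot s ∷ᵥ mapᵥ (embed s) xs , pruning-covering s xs covering

vertices : ∀ t → List (Vertex t)
vertices leaf       = [ root ]
vertices (node l r) = root ∷ map left (vertices l) ++ map right (vertices r)

∈-vertices : ∀ {t} (v : Vertex t) → v ∈ vertices t
∈-vertices {leaf}     root      = here refl
∈-vertices {node l r} root      = here refl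
∈-vertices {node l r} (left v)  = there (∈-++⁺ˡ (∈-map⁺ left (∈-vertices v)))
∈-vertices {node l r} (right v) = there (∈-++⁺ʳ (map left (vertices l)) (∈-map⁺ right (∈-vertices v)))

_≟_ : ∀ {t} → DecidableEquality (Vertex t)
root    ≟ root    = yes refl
left u  ≟ left v  = map′ (cong left) (λ { refl → refl }) (u ≟ v)
right u ≟ right v = map′ (cong right) (λ { refl → refl }) (u ≟ v)
root    ≟ left _  = no λ ()
root    ≟ right _ = no λ ()
left _  ≟ root    = no λ ()
left _  ≟ right _ = no λ ()
right _ ≟ root    = no λ ()
right _ ≟ left _  = no λ ()

childOf? : ∀ {t} → Decidable (ChildOf {t})
childOf? root              _         = no λ ()
childOf? (left root)       root      = yes lchild
childOf? (left (left _))   root      = no λ ()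
childOf? (left (right _))  root      = no λ ()
childOf? (left c)          (left p)  = map′ inL (λ { (inL c<p) → c<p }) (childOf? c p)
childOf? (left _)          (right _) = no λ ()
childOf? (right root)      root      = yes rchild
childOf? (right (left _))  root      = no λ ()
childOf? (right (right _)) root      = no λ ()
childOf? (right c)         (right p) = map′ inR (λ { (inR c<p) → c<p }) (childOf? c p)
childOf? (right _)         (left _)  = no λ ()

adj? : ∀ t → Decidable (Adj t)
adj? t u v = childOf? u v ⊎-dec childOf? v u

corollary2 : (T : FBT) (n k : ℕ) → order T ≡ n → IsCeilSqrt n k → BurningNumber≤ (Adj T) k
corollary2 T _ k refl (n≤k² , _) = Product.uncurry covering⇒burningNumber≤ (cover k T n≤k²)
  where open FiniteGraph (vertices T) ∈-vertices (adj? T) _≟_
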